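{- In any execution of algorithm $\Gamma$ (described below), $r(n+1)\le w(\bar C\cup U)$.
   Context: Let $P$ be a set with partial order $\triangleleft$. The input is $\delta\in(0,1]$, $\gamma>0$, and elements $\sigma(1),\ldots,\sigma(n)\in P$ with nonnegative integer weights $w(1),\ldots,w(n)$; extend by $\sigma(n+1)$ greater than all elements of $P$ with $w(n+1)=0$, and an index $0$ with $\sigma(0)$ below everything. Write $i\to t$ for $i<t$ and $\sigma(i)\triangleleft\sigma(t)$. For $J\subseteq[n+1]$, $w(J)=\sum_{j\in J}w(j)$; $W(0)=0$, $W(t)=W(t-1)+w(t)$. Define $q(i,t)=\min\{1,\frac{1+\delta}{\delta}\ln(4t^3/\gamma)\frac{w(i)}{W(t)-W(i-1)}\}$, $p(i,i)=1$, $p(i,t)=q(i,t)/q(i,t-1)$ for $t>i$. Algorithm $\Gamma$: initialize $R=\{0\}$, $r(0)=0$. For $t=1,\ldots,n+1$: set $r(t)=\min\{r(i)+W(t-1)-W(i): i\in R,\ i\to t\}$; insert $t$ into $R$; discard each $i\in R$, $i\ge1$, independently with probability $1-p(i,t)$ (index 0 is never discarded). Let $R^t$ be the set $R$ at the end of step $t$ and $F^t=[t]\setminus R^t$ (indices forgotten by time $t$). Let $C\subseteq[n+1]$ be a fixed set of indices $c_1<\cdots<c_m$ with $c_m=n+1$ and $\sigma(c_1)\triangleleft\cdots\triangleleft\sigma(c_m)$, chosen so that $w([n+1]\setminus C)$ is minimum among all such sets; let $\bar C=[n+1]\setminus C$. An index $i\in C$ is unsafe at time $t$ if $C\cap[i,t]\subseteq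 F^t$; $U^t$ is the set of indices unsafe at time $t$, and $U$ is the set of indices $i\in C$ that are unsafe at some time $t>i$. -}

module Defs where

open import Level using (Level)
open import Data.Nat using (ℕ; zero; suc; _+_; _∸_; _≤_; _<_; _≤ᵇ_; _≟_)
open import Data.Bool using (Bool; true; false; if_then_else_; _∧_; not)
open import Data.List using (List; []; _∷_)
open import Data.List.Membership.DecPropositional _≟_ using (_∈_; _∈?_)
open import Data.Product using (_×_; ∃)
open import Data.Sum using (_⊎_)
open import Relation.Binary.PropositionalEquality using (_≡_)
open import Relation.Nullary using (¬_; does)
open import Relation.Binary.Bundles using (Poset)

Σ1 : (ℕ → ℕ) → ℕ → ℕ
Σ1 f zero = 0
Σ1 f (suc t) = Σ1 f t + f (suc t)

wExt : ℕ → (ℕ → ℕ) → ℕ → ℕ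
wExt n w zero = 0
wExt n w (suc i) = if suc i ≤ᵇ n then w (suc i) else 0

W : ℕ → (ℕ → ℕ) → ℕ → ℕ
W n w t = Σ1 (wExt n w) t

wSet : ℕ → (ℕ → ℕ) → (ℕ → Bool) → ℕ
wSet n w S = Σ1 (λ i → if S i then wExt n w i else 0) (suc n)

wCompl : ℕ → (ℕ → ℕ) → List ℕ → ℕ
wCompl n w C = Σ1 (λ i → if does (i ∈? C) then 0 else wExt n w i) (suc n)

module _ {c ℓ₁ ℓ₂ : Level} (P : Poset c ℓ₁ ℓ₂) where
  open Poset P using () renaming (Carrier to A; _≤_ to _◁_)

  -- extended order on indices: σ(0) below everything, σ(n+1) above everything
  ExtLe : ℕ → (ℕ → A) → ℕ → ℕ → Set ℓ₂
  ExtLe n σ i t = (i ≡ 0) ⊎ ((t ≡ suc n) ⊎ (σ i ◁ σ t))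

  Arrow : ℕ → (ℕ → A) → ℕ → ℕ → Set ℓ₂
  Arrow n σ i t = (i < t) × ExtLe n σ i t

  data Chain (n : ℕ) (σ : ℕ → A) : List ℕ → Set ℓ₂ where
    last : Chain n σ (suc n ∷ [])
    cons : ∀ {a b cs} → 1 ≤ a → a < b → ExtLe n σ a b →
           Chain n σ (b ∷ cs) → Chain n σ (a ∷ b ∷ cs)

-- Execution of Γ given discard decisions d : d t i ≡ true means that i
-- (if present, i ≥ 1, i ≠ t) is discarded in step t.
-- InR d t i  ⇔  i ∈ R^t.  (p(t,t) = 1, so t is never discarded at step t.)
InR : (ℕ → ℕ → Bool) → ℕ → ℕ → Set
InR d zero i = i ≡ 0
InR d (suc t) i = (i ≡ suc t) ⊎ (InR d t i × ((i ≡ 0) ⊎ (d (suc t) i ≡ false)))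

Forgotten : (ℕ → ℕ → Bool) → ℕ → ℕ → Set
Forgotten d t i = (1 ≤ i) × ((i ≤ t) × ¬ InR d t i)

NotSafe : (ℕ → ℕ → Bool) → List ℕ → ℕ → ℕ → Set
NotSafe d C i t = (i ∈ C) × (∀ j → j ∈ C → i ≤ j → j ≤ t → Forgotten d t j)

InU : ℕ → (ℕ → ℕ → Bool) → List ℕ → ℕ → Set
InU n d C i = ∃ λ t → (i < t) × ((t ≤ suc n) × NotSafe d C i t)

module Submission where

open import Defs
open import Level using (Level)
open import Data.Nat using (ℕ; zero; suc; _+_; _∸_; _≤_; _<_; _≟_; z≤n; s≤s; z<s)
open import Data.Nat.Properties
open import Data.Nat.Induction using (<-rec)
open import Data.Bool using (Bool; true; false; if_then_else_)
import Data.Bool as Bool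
open import Data.List using (List; _∷_)
open import Data.List.Relation.Unary.Any using (here; there)
open import Data.List.Membership.DecPropositional _≟_ using (_∈_; _∈?_)
open import Data.Product using (_×_; ∃; _,_; proj₁; proj₂)
open import Data.Sum using (_⊎_; inj₁; inj₂)
open import Data.Empty using (⊥-elim)
open import Relation.Binary.PropositionalEquality using (_≡_; refl; sym)
open import Relation.Nullary using (¬_; yes; no)
open import Relation.Nullary.Decidable using (_×-dec_; _⊎-dec_)
open import Relation.Unary using (Pred; Decidable)
open import Relation.Binary.Bundles using (Poset)

-- Let t ≤ n+1 with t ∈ C and let k < t be the last index that is 0 or lies in C ∩ R^{t-1}.
-- Every index of C strictly between k and t is forgotten at time t-1, hence unsafe then,
-- so the whole interval (k, t) lies in C̄ ∪ U.  Relaxing r(t) along the edge k → t gives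
-- r(t) ≤ r(k) + w(k+1) + … + w(t-1), and strong induction along C bounds r(k) by the
-- weight of (C̄ ∪ U) ∩ [1, k].  At t = n+1 this is the theorem.

m+n∸o≤m∸o+n : ∀ m n o → (m + n) ∸ o ≤ (m ∸ o) + n
m+n∸o≤m∸o+n m       n zero    = ≤-refl
m+n∸o≤m∸o+n zero    n (suc o) = m∸n≤m n (suc o)
m+n∸o≤m∸o+n (suc m) n (suc o) = m+n∸o≤m∸o+n m n o

Σ1-pred-≤ : ∀ f k → Σ1 f (k ∸ 1) ≤ Σ1 f k
Σ1-pred-≤ f zero    = ≤-refl
Σ1-pred-≤ f (suc k) = m≤m+n (Σ1 f k) (f (suc k))

Σ1-tail-mono : ∀ f g {k m} → k ≤ m → (∀ i → k < i → i ≤ m → f i ≤ g i) →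
               Σ1 g k + (Σ1 f m ∸ Σ1 f k) ≤ Σ1 g m
Σ1-tail-mono f g {k} {zero} z≤n f≤g = ≤-refl
Σ1-tail-mono f g {k} {suc m} k≤1+m f≤g with m≤n⇒m<n∨m≡n k≤1+m
... | inj₂ refl
  rewrite n∸n≡0 (Σ1 f (suc m)) | +-identityʳ (Σ1 g (suc m)) = ≤-refl
... | inj₁ (s≤s k≤m) = begin
  Σ1 g k + ((Σ1 f m + f (suc m)) ∸ Σ1 f k)
    ≤⟨ +-monoʳ-≤ (Σ1 g k) (m+n∸o≤m∸o+n (Σ1 f m) (f (suc m)) (Σ1 f k)) ⟩
  Σ1 g k + ((Σ1 f m ∸ Σ1 f k) + f (suc m))
    ≡⟨ sym (+-assoc (Σ1 g k) _ _) ⟩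
  (Σ1 g k + (Σ1 f m ∸ Σ1 f k)) + f (suc m)
    ≤⟨ +-mono-≤ (Σ1-tail-mono f g k≤m (λ i k<i i≤m → f≤g i k<i (m≤n⇒m≤1+n i≤m)))
                (f≤g (suc m) (s≤s k≤m) ≤-refl) ⟩
  Σ1 g m + g (suc m) ∎
  where open ≤-Reasoning

last-below : ∀ {p} {Q : Pred ℕ p} → Decidable Q → ∀ m →
             ∃ λ k → k ≤ m × (k ≡ 0 ⊎ Q k) × (∀ j → k < j → j ≤ m → ¬ Q j)
last-below Q? zero = 0 , z≤n , inj₁ refl , λ j 0<j j≤0 _ → <-irrefl refl (<-≤-trans 0<j j≤0)
last-below Q? (suc m) with Q? (suc m)
... | yes q = suc m , ≤-refl , inj₂ q , λ j m<j j≤m _ → <-irrefl refl (<-≤-trans m<j j≤m)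
last-below {Q = Q} Q? (suc m) | no ¬q with last-below Q? m
...   | k , k≤m , qk , none = k , m≤n⇒m≤1+n k≤m , qk , none′
  where
  none′ : ∀ j → k < j → j ≤ suc m → ¬ Q j
  none′ j k<j j≤1+m with m≤n⇒m<n∨m≡n j≤1+m
  ... | inj₁ (s≤s j≤m) = none j k<j j≤m
  ... | inj₂ refl      = ¬q

InR-zero : ∀ d t → InR d t 0
InR-zero d zero    = refl
InR-zero d (suc t) = inj₂ (InR-zero d t , inj₁ refl)

InR-self : ∀ d t → 1 ≤ t → InR d t t
InR-self d (suc t) _ = inj₁ refl

InR? : ∀ d t → Decidable (InR d t)
InR? d zero    i = i ≟ 0
InR? d (suc t) i =
  (i ≟ suc t) ⊎-dec (InR? d t i ×-dec ((i ≟ 0) ⊎-dec (d (suc t) i Bool.≟ false)))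

forgotten-gap⊆C̄∪U : ∀ n d C {k m} → m ≤ suc n →
  (∀ j → k < j → j ≤ m → ¬ (j ∈ C × InR d m j)) →
  ∀ i → k < i → i ≤ m → (¬ i ∈ C) ⊎ InU n d C i
forgotten-gap⊆C̄∪U n d C {k} {m} m≤1+n forgotten i k<i i≤m with i ∈? C
... | no  i∉C = inj₁ i∉C
... | yes i∈C = inj₂ (m , i<m , m≤1+n , i∈C , unsafe)
  where
  1≤i : 1 ≤ i
  1≤i = <-≤-trans z<s k<i

  i<m : i < m
  i<m = ≤∧≢⇒< i≤m λ { refl → forgotten i k<i i≤m (i∈C , InR-self d i 1≤i) }

  unsafe : ∀ j → j ∈ C → i ≤ j → j ≤ m → Forgotten d m j
  unsafe j j∈C i≤j j≤m = ≤-trans 1≤i i≤j , j≤m , λ j∈R → forgotten j (<-≤-trans k<i i≤j) j≤m (j∈C , j∈R)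

module _ {c ℓ₁ ℓ₂ : Level} (P : Poset c ℓ₁ ℓ₂) {n : ℕ} {σ : ℕ → Poset.Carrier P} where

  ExtLe-trans : ∀ {a b x} → 1 ≤ a → a < b → b < x → x ≤ suc n →
                ExtLe P n σ a b → ExtLe P n σ b x → ExtLe P n σ a x
  ExtLe-trans 1≤a _   _   _   (inj₁ refl)        _                  = ⊥-elim (<-irrefl refl 1≤a)
  ExtLe-trans _   _   b<x x≤  (inj₂ (inj₁ refl)) _                  = ⊥-elim (<-irrefl refl (<-≤-trans b<x x≤))
  ExtLe-trans _   a<b _   _   (inj₂ (inj₂ _))    (inj₁ refl)        = ⊥-elim (n≮0 a<b)
  ExtLe-trans _   _   _   _   (inj₂ (inj₂ _))    (inj₂ (inj₁ refl)) = inj₂ (inj₁ refl)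
  ExtLe-trans _   _   _   _   (inj₂ (inj₂ a◁b))  (inj₂ (inj₂ b◁x))  = inj₂ (inj₂ (Poset.trans P a◁b b◁x))

  Chain-bounds : ∀ {C} → Chain P n σ C → ∀ {x} → x ∈ C → 1 ≤ x × x ≤ suc n
  Chain-bounds last                (here refl) = s≤s z≤n , ≤-refl
  Chain-bounds (cons 1≤a a<b _ ch) (here refl) = 1≤a , <⇒≤ (<-≤-trans a<b (proj₂ (Chain-bounds ch (here refl))))
  Chain-bounds (cons _ _ _ ch)     (there x∈C) = Chain-bounds ch x∈C

  Chain-last : ∀ {C} → Chain P n σ C → suc n ∈ C
  Chain-last last            = here refl
  Chain-last (cons _ _ _ ch) = there (Chain-last ch)

  Chain-head-below : ∀ {a C} → Chain P n σ (a ∷ C) → ∀ {x} → x ∈ C → a < x × ExtLe P n σ a x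
  Chain-head-below (cons _   a<b a≤b _)  (here refl)  = a<b , a≤b
  Chain-head-below (cons 1≤a a<b a≤b ch) (there x∈C) =
    let b<x , b≤x = Chain-head-below ch x∈C
    in  <-trans a<b b<x
      , ExtLe-trans 1≤a a<b b<x (proj₂ (Chain-bounds ch (there x∈C))) a≤b b≤x

  Chain-ordered : ∀ {C} → Chain P n σ C → ∀ {a b} → a ∈ C → b ∈ C → a < b → ExtLe P n σ a b
  Chain-ordered ch              (here refl) (here refl) a<a = ⊥-elim (<-irrefl refl a<a)
  Chain-ordered ch              (here refl) (there b∈C) _   = proj₂ (Chain-head-below ch b∈C)
  Chain-ordered ch              (there a∈C) (here refl) a<b = ⊥-elim (<-asym a<b (proj₁ (Chain-head-below ch a∈C)))
  Chain-ordered (cons _ _ _ ch) (there a∈C) (there b∈C) a<b = Chain-ordered ch a∈C b∈C a<b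

  module Γ-bound (w : ℕ → ℕ) (d : ℕ → ℕ → Bool) (r : ℕ → ℕ) (r0≡0 : r 0 ≡ 0)
    (r-relax : ∀ t → 1 ≤ t → t ≤ suc n → ∀ i → InR d (t ∸ 1) i → Arrow P n σ i t →
               r t ≤ r i + (W n w (t ∸ 1) ∸ W n w i))
    {C : List ℕ} (ch : Chain P n σ C) (S : ℕ → Bool)
    (C̄∪U⊆S : ∀ i → 1 ≤ i → i ≤ suc n → (¬ i ∈ C) ⊎ InU n d C i → S i ≡ true) where

    wS : ℕ → ℕ
    wS i = if S i then wExt n w i else 0

    wExt≤wS : ∀ i → S i ≡ true → wExt n w i ≤ wS i
    wExt≤wS i Si rewrite Si = ≤-refl

    relax-bound : ∀ {k m} → suc m ≤ suc n → k ≤ m → InR d m k → ExtLe P n σ k (suc m) →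
                  r k ≤ Σ1 wS k → (∀ i → k < i → i ≤ m → S i ≡ true) → r (suc m) ≤ Σ1 wS m
    relax-bound {k} {m} t≤1+n k≤m k∈R k◁t rk≤ gap⊆S = begin
      r (suc m)                     ≤⟨ r-relax (suc m) (s≤s z≤n) t≤1+n k k∈R (s≤s k≤m , k◁t) ⟩
      r k + (W n w m ∸ W n w k)     ≤⟨ +-monoˡ-≤ _ rk≤ ⟩
      Σ1 wS k + (W n w m ∸ W n w k) ≤⟨ Σ1-tail-mono (wExt n w) wS k≤m
                                         (λ i k<i i≤m → wExt≤wS i (gap⊆S i k<i i≤m)) ⟩
      Σ1 wS m                       ∎
      where open ≤-Reasoning

    r≤weight-before : ∀ a → a ∈ C → r a ≤ Σ1 wS (a ∸ 1)
    r≤weight-before = <-rec (λ a → a ∈ C → r a ≤ Σ1 wS (a ∸ 1)) step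
      where
      step : ∀ a → (∀ {b} → b < a → b ∈ C → r b ≤ Σ1 wS (b ∸ 1)) → a ∈ C → r a ≤ Σ1 wS (a ∸ 1)
      step zero    _  0∈C = ⊥-elim (<-irrefl refl (proj₁ (Chain-bounds ch 0∈C)))
      step (suc m) ih t∈C = from-last-survivor (last-below (λ j → (j ∈? C) ×-dec InR? d m j) m)
        where
        t≤1+n : suc m ≤ suc n
        t≤1+n = proj₂ (Chain-bounds ch t∈C)

        m≤1+n : m ≤ suc n
        m≤1+n = ≤-trans (n≤1+n m) t≤1+n

        gap⊆S : ∀ {k} → (∀ j → k < j → j ≤ m → ¬ (j ∈ C × InR d m j)) →
                ∀ i → k < i → i ≤ m → S i ≡ true
        gap⊆S forgotten i k<i i≤m =
          C̄∪U⊆S i (<-≤-trans z<s k<i) (≤-trans i≤m m≤1+n)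
                 (forgotten-gap⊆C̄∪U n d C m≤1+n forgotten i k<i i≤m)

        from-last-survivor : (∃ λ k → k ≤ m × (k ≡ 0 ⊎ (k ∈ C × InR d m k))
                                    × (∀ j → k < j → j ≤ m → ¬ (j ∈ C × InR d m j))) →
                             r (suc m) ≤ Σ1 wS m
        from-last-survivor (_ , k≤m , inj₁ refl , forgotten) =
          relax-bound t≤1+n k≤m (InR-zero d m) (inj₁ refl) (≤-reflexive r0≡0) (gap⊆S forgotten)
        from-last-survivor (k , k≤m , inj₂ (k∈C , k∈R) , forgotten) =
          relax-bound t≤1+n k≤m k∈R (Chain-ordered ch k∈C t∈C (s≤s k≤m))
                      (≤-trans (ih (s≤s k≤m) k∈C) (Σ1-pred-≤ wS k)) (gap⊆S forgotten)

lemma1 : {c ℓ₁ ℓ₂ : Level} (P : Poset c ℓ₁ ℓ₂) (n : ℕ)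
    (σ : ℕ → Poset.Carrier P) (w : ℕ → ℕ)
    (d : ℕ → ℕ → Bool) (r : ℕ → ℕ) →
    r 0 ≡ 0 →
    (∀ t → 1 ≤ t → t ≤ suc n →
      (∀ i → InR d (t ∸ 1) i → Arrow P n σ i t →
        r t ≤ r i + (W n w (t ∸ 1) ∸ W n w i))
      × (∃ λ i → InR d (t ∸ 1) i × (Arrow P n σ i t
          × (r t ≡ r i + (W n w (t ∸ 1) ∸ W n w i))))) →
    (C : List ℕ) → Chain P n σ C →
    (∀ C′ → Chain P n σ C′ → wCompl n w C ≤ wCompl n w C′) →
    (S : ℕ → Bool) →
    (∀ i → 1 ≤ i → i ≤ suc n →
      ((S i ≡ true → (¬ (i ∈ C)) ⊎ InU n d C i)
       × ((¬ (i ∈ C)) ⊎ InU n d C i → S i ≡ true))) →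
    r (suc n) ≤ wSet n w S
lemma1 P n σ w d r r0≡0 r-spec C ch _ S S-spec =
  ≤-trans (r≤weight-before (suc n) (Chain-last P ch)) (Σ1-pred-≤ wS (suc n))
  where
  open Γ-bound P w d r r0≡0 (λ t 1≤t t≤1+n → proj₁ (r-spec t 1≤t t≤1+n))
               ch S (λ i 1≤i i≤1+n → proj₂ (S-spec i 1≤i i≤1+n))
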